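{- Let $r$ be a positive integer such that $n/r$ is an integer. If there exists an $(n,b,d,\delta)$-LPHS, then there exists an $(n/r,b\cdot r,d,r\cdot\delta)$-LPHS.
   Context: $\Sigma_b=\{0,1\}^b$. An $(n,b,d,\delta)$-LPHS is a function $h:\Sigma_b^n\to\mathbb{Z}_n$ (entries of the input indexed by $\mathbb{Z}_n$) that can be computed by making $d$ adaptive queries $x[i]$ to its input and satisfies $\Pr_{x}[h(x)\neq h(x\ll1)+1]\le\delta$ for uniform $x\in\Sigma_b^n$, where $x\ll1$ is the cyclic shift $(x\ll1)[i]=x[i+1\bmod n]$.
   Formalization: The error bound δ of an LPHS ranges over the rationals. -}

module Defs where

open import Data.Bool using (Bool; true; false)
open import Data.Nat as ℕ using (ℕ; zero; suc; _^_; NonZero)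
open import Data.Nat.Properties using (m^n≢0)
open import Data.Nat.DivMod using (_%_; m%n<n)
open import Data.Fin as Fin using (Fin; toℕ; fromℕ<; _≟_)
open import Data.Vec as Vec using (Vec; []; _∷_; lookup)
open import Data.List as List using (List; []; _∷_; length; filter; map; concatMap)
open import Data.Integer using (+_)
open import Data.Rational as ℚ using (ℚ)
open import Data.Product using (Σ; ∃; _×_)
open import Relation.Binary.PropositionalEquality using (_≡_)
open import Relation.Nullary using (¬?)

Σᵇ : ℕ → Set
Σᵇ b = Vec Bool b

-- An input x ∈ Σ_b^n, entries indexed by ℤ_n (represented as Fin n)
Input : ℕ → ℕ → Set
Input n b = Fin n → Σᵇ b

sucMod : {n : ℕ} → Fin n → Fin n
sucMod {suc n} i = fromℕ< (m%n<n (suc (toℕ i)) (suc n))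

shift : {n b : ℕ} → Input n b → Input n b
shift x i = x (sucMod i)

-- Adaptive query algorithms (decision trees) making at most d queries
-- to an input in Σ_b^n and outputting an element of ℤ_n.
data QueryAlg (n b : ℕ) : ℕ → Set where
  output : {d : ℕ} → Fin n → QueryAlg n b d
  query  : {d : ℕ} → Fin n → (Σᵇ b → QueryAlg n b d) → QueryAlg n b (suc d)

run : {n b d : ℕ} → QueryAlg n b d → Input n b → Fin n
run (output v)  x = v
run (query i k) x = run (k (x i)) x

ComputableWith : (n b d : ℕ) → (Input n b → Fin n) → Set
ComputableWith n b d h = Σ (QueryAlg n b d) λ A → ∀ x → h x ≡ run A x

allΣ : (b : ℕ) → List (Σᵇ b)
allΣ zero    = [] ∷ []
allΣ (suc b) = concatMap (λ v → map (_∷ v) (true ∷ false ∷ [])) (allΣ b)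

allVec : {A : Set} → List A → (n : ℕ) → List (Vec A n)
allVec xs zero    = [] ∷ []
allVec xs (suc n) = concatMap (λ v → map (_∷ v) xs) (allVec xs n)

allInputs : (n b : ℕ) → List (Input n b)
allInputs n b = map lookup (allVec (allΣ b) n)

badCount : (n b : ℕ) → (Input n b → Fin n) → ℕ
badCount n b h = length (filter (λ x → ¬? (h x ≟ sucMod (h (shift x)))) (allInputs n b))

-- Pr_x[h(x) ≠ h(x ≪ 1) + 1] for uniform x ∈ Σ_b^n (there are 2^(b n) inputs)
errorProb : (n b : ℕ) → (Input n b → Fin n) → ℚ
errorProb n b h = (+ badCount n b h) ℚ./ (2 ^ (b ℕ.* n))
  where instance _ = m^n≢0 2 (b ℕ.* n)

IsLPHS : (n b d : ℕ) → ℚ → (Input n b → Fin n) → Set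
IsLPHS n b d δ h = ComputableWith n b d h × (errorProb n b h ℚ.≤ δ)

LPHSExists : (n b d : ℕ) → ℚ → Set
LPHSExists n b d δ = ∃ λ (h : Input n b → Fin n) → IsLPHS n b d δ h

-- Write n = m·r and group the positions of ℤ_n into m consecutive blocks of r; a symbol
-- of b·r bits encodes the r symbols of one block, which identifies Σ_{b·r}^m with Σ_b^n
-- and maps the uniform distribution to the uniform distribution.  The new hash
-- simulates the old one, answering a query to position i by querying the block of i,
-- and outputs the block of the old output.  Shifting the encoded input by one block
-- shifts the decoded input x by r positions, so if the old hash is consistent on each
-- of x, x ≪ 1, …, x ≪ (r − 1), its output moves by exactly r, i.e. by one block.
-- Each x ≪ j is again uniform, and the union bound over j < r gives the error r·δ.
module Submission where

open import Defs
open import Data.Bool using (Bool; true; false)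
open import Data.Empty using (⊥-elim)
open import Data.Fin as Fin
  using (Fin; zero; suc; toℕ; fromℕ; inject₁; lower₁; combine; remQuot; quotient; remainder; _≟_)
open import Data.Fin.Properties
  using (toℕ-injective; toℕ<n; toℕ-fromℕ; toℕ-fromℕ<; toℕ-inject₁; toℕ-combine; inject₁-lower₁;
         remQuot-combine; combine-remQuot)
open import Data.Integer using (+_)
import Data.Integer as ℤ
import Data.Integer.Properties as ℤ
open import Data.List as List using (List; []; _∷_; _++_; map; concatMap; filter; length)
open import Data.List.Relation.Unary.All using (All; []; _∷_)
open import Data.Nat using (ℕ; zero; suc; _+_; _*_; _^_; _≤_; z≤n; s≤s; NonZero)
open import Data.Nat.DivMod
open import Data.Nat.Divisibility using (_∣_; divides)
open import Data.Nat.GeneralisedArithmetic using (fold; iterate)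
open import Data.Nat.Properties hiding (_≟_)
open import Algebra.Properties.CommutativeSemigroup +-commutativeSemigroup using (interchange)
open import Data.Nat.Tactic.RingSolver using (solve-∀)
open import Data.Product using (_,_; proj₁; uncurry)
open import Data.Rational as ℚ using (ℚ)
import Data.Rational.Properties as ℚ
open import Data.Rational.Unnormalised using (mkℚᵘ; *≤*)
import Data.Rational.Unnormalised.Properties as ℚᵘ
open import Data.Vec as Vec using (Vec; []; _∷_; _∷ʳ_; lookup; tabulate; concat; cast)
open import Data.Vec.Properties using (lookup-map; lookup-concat; lookup-cast; tabulate∘lookup; tabulate-cong)
open import Data.Vec.Relation.Binary.Equality.Cast using (cast-is-id)
open import Function using (_∘_)
open import Relation.Binary.Core using (_Preserves_⟶_)
open import Relation.Binary.PropositionalEquality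
open import Relation.Nullary using (Dec; yes; no; ¬?)

private
  variable
    A B : Set
    n b : ℕ

∑ : List A → (A → ℕ) → ℕ
∑ []       f = 0
∑ (x ∷ xs) f = f x + ∑ xs f

syntax ∑ xs (λ x → e) = ∑[ x ∈ xs ] e

∑-cong : ∀ (xs : List A) {f g : A → ℕ} → f ≗ g → ∑ xs f ≡ ∑ xs g
∑-cong []       f≗g = refl
∑-cong (x ∷ xs) f≗g = cong₂ _+_ (f≗g x) (∑-cong xs f≗g)

∑-mono-≤ : ∀ (xs : List A) {f g : A → ℕ} → (∀ x → f x ≤ g x) → ∑ xs f ≤ ∑ xs g
∑-mono-≤ []       f≤g = z≤n
∑-mono-≤ (x ∷ xs) f≤g = +-mono-≤ (f≤g x) (∑-mono-≤ xs f≤g)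

∑-zero : ∀ (xs : List A) → ∑[ _ ∈ xs ] 0 ≡ 0
∑-zero []       = refl
∑-zero (x ∷ xs) = ∑-zero xs

∑-distrib-+ : ∀ (xs : List A) (f g : A → ℕ) → ∑[ x ∈ xs ] (f x + g x) ≡ ∑ xs f + ∑ xs g
∑-distrib-+ []       f g = refl
∑-distrib-+ (x ∷ xs) f g =
  trans (cong (_+_ (f x + g x)) (∑-distrib-+ xs f g)) (interchange (f x) (g x) _ _)

∑-++ : ∀ (xs ys : List A) (f : A → ℕ) → ∑ (xs ++ ys) f ≡ ∑ xs f + ∑ ys f
∑-++ []       ys f = refl
∑-++ (x ∷ xs) ys f = trans (cong (_+_ (f x)) (∑-++ xs ys f)) (sym (+-assoc (f x) _ _))

∑-map : ∀ (g : A → B) (xs : List A) (f : B → ℕ) → ∑ (map g xs) f ≡ ∑ xs (f ∘ g)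
∑-map g []       f = refl
∑-map g (x ∷ xs) f = cong (_+_ (f (g x))) (∑-map g xs f)

∑-concatMap : ∀ (g : A → List B) (xs : List A) (f : B → ℕ) →
              ∑ (concatMap g xs) f ≡ ∑[ x ∈ xs ] ∑ (g x) f
∑-concatMap g []       f = refl
∑-concatMap g (x ∷ xs) f =
  trans (∑-++ (g x) (concatMap g xs) f) (cong (_+_ (∑ (g x) f)) (∑-concatMap g xs f))

∑-comm : ∀ (xs : List A) (ys : List B) (f : A → B → ℕ) →
         ∑[ x ∈ xs ] ∑[ y ∈ ys ] f x y ≡ ∑[ y ∈ ys ] ∑[ x ∈ xs ] f x y
∑-comm []       ys f = sym (∑-zero ys)
∑-comm (x ∷ xs) ys f =
  trans (cong (_+_ (∑ ys (f x))) (∑-comm xs ys f)) (sym (∑-distrib-+ ys (f x) _))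

𝟙¬ : {P : Set} → Dec P → ℕ
𝟙¬ (yes _) = 0
𝟙¬ (no  _) = 1

length-filter-¬ : ∀ {P : A → Set} (P? : ∀ x → Dec (P x)) (xs : List A) →
                  length (filter (¬? ∘ P?) xs) ≡ ∑[ x ∈ xs ] 𝟙¬ (P? x)
length-filter-¬ P? []       = refl
length-filter-¬ P? (x ∷ xs) with P? x
... | yes _ = length-filter-¬ P? xs
... | no  _ = cong suc (length-filter-¬ P? xs)

𝟙¬-union-bound : ∀ {P : Set} {Q : A → Set} (P? : Dec P) (Q? : ∀ x → Dec (Q x)) (xs : List A) →
                 (All Q xs → P) → 𝟙¬ P? ≤ ∑[ x ∈ xs ] 𝟙¬ (Q? x)
𝟙¬-union-bound (yes _) Q? xs       all⇒P = z≤n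
𝟙¬-union-bound (no ¬p) Q? []       all⇒P = ⊥-elim (¬p (all⇒P []))
𝟙¬-union-bound (no ¬p) Q? (x ∷ xs) all⇒P with Q? x
... | yes q = 𝟙¬-union-bound (no ¬p) Q? xs (all⇒P ∘ (q ∷_))
... | no  _ = s≤s z≤n

rotate : Vec A n → Vec A n
rotate []      = []
rotate (a ∷ v) = v ∷ʳ a

∑-allVec-∷ : ∀ (xs : List A) n (f : Vec A (suc n) → ℕ) →
             ∑ (allVec xs (suc n)) f ≡ ∑[ a ∈ xs ] ∑[ v ∈ allVec xs n ] f (a ∷ v)
∑-allVec-∷ xs n f = begin
  ∑ (allVec xs (suc n)) f                      ≡⟨ ∑-concatMap _ (allVec xs n) f ⟩
  ∑[ v ∈ allVec xs n ] ∑ (map (_∷ v) xs) f      ≡⟨ ∑-cong (allVec xs n) (λ v → ∑-map (_∷ v) xs f) ⟩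
  ∑[ v ∈ allVec xs n ] ∑[ a ∈ xs ] f (a ∷ v)    ≡⟨ ∑-comm (allVec xs n) xs _ ⟩
  ∑[ a ∈ xs ] ∑[ v ∈ allVec xs n ] f (a ∷ v)    ∎
  where open ≡-Reasoning

∑-allVec-∷ʳ : ∀ (xs : List A) n (f : Vec A (suc n) → ℕ) →
              ∑ (allVec xs (suc n)) f ≡ ∑[ a ∈ xs ] ∑[ v ∈ allVec xs n ] f (v ∷ʳ a)
∑-allVec-∷ʳ xs zero    f = ∑-allVec-∷ xs zero f
∑-allVec-∷ʳ xs (suc n) f = begin
  ∑ (allVec xs (suc (suc n))) f
    ≡⟨ ∑-allVec-∷ xs (suc n) f ⟩
  ∑[ a ∈ xs ] ∑ (allVec xs (suc n)) (f ∘ (a ∷_))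
    ≡⟨ ∑-cong xs (λ a → ∑-allVec-∷ʳ xs n (f ∘ (a ∷_))) ⟩
  ∑[ a ∈ xs ] ∑[ c ∈ xs ] ∑[ w ∈ allVec xs n ] f (a ∷ (w ∷ʳ c))
    ≡⟨ ∑-comm xs xs _ ⟩
  ∑[ c ∈ xs ] ∑[ a ∈ xs ] ∑[ w ∈ allVec xs n ] f (a ∷ (w ∷ʳ c))
    ≡⟨ ∑-cong xs (λ c → sym (∑-allVec-∷ xs n (λ u → f (u ∷ʳ c)))) ⟩
  ∑[ c ∈ xs ] ∑[ u ∈ allVec xs (suc n) ] f (u ∷ʳ c)
    ∎
  where open ≡-Reasoning

∑-allVec-rotate : ∀ (xs : List A) n (f : Vec A n → ℕ) →
                  ∑ (allVec xs n) (f ∘ rotate) ≡ ∑ (allVec xs n) f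
∑-allVec-rotate xs zero    f = refl
∑-allVec-rotate xs (suc n) f = trans (∑-allVec-∷ xs n (f ∘ rotate)) (sym (∑-allVec-∷ʳ xs n f))

∑-allVec-++ : ∀ (xs : List A) p q (f : Vec A (p + q) → ℕ) →
              ∑ (allVec xs (p + q)) f ≡ ∑[ u ∈ allVec xs p ] ∑[ w ∈ allVec xs q ] f (u Vec.++ w)
∑-allVec-++ xs zero    q f = sym (+-identityʳ _)
∑-allVec-++ xs (suc p) q f =
  trans (∑-allVec-∷ xs (p + q) f)
    (trans (∑-cong xs (λ a → ∑-allVec-++ xs p q (f ∘ (a ∷_)))) (sym (∑-allVec-∷ xs p _)))

∑-allVec-concat : ∀ (xs : List A) m r (f : Vec A (m * r) → ℕ) →
                  ∑ (allVec xs (m * r)) f ≡ ∑ (allVec (allVec xs r) m) (f ∘ concat)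
∑-allVec-concat xs zero    r f = refl
∑-allVec-concat xs (suc m) r f =
  trans (∑-allVec-++ xs r (m * r) f)
    (trans (∑-cong (allVec xs r) (λ u → ∑-allVec-concat xs m r (f ∘ (u Vec.++_))))
           (sym (∑-allVec-∷ (allVec xs r) m (f ∘ concat))))

∑-allVec-cast : ∀ (xs : List A) {m n} (eq : m ≡ n) (f : Vec A n → ℕ) →
                ∑ (allVec xs m) (f ∘ cast eq) ≡ ∑ (allVec xs n) f
∑-allVec-cast xs refl f = ∑-cong (allVec xs _) (cong f ∘ cast-is-id refl)

∑-allVec-map : ∀ (xs : List A) (ys : List B) (g : B → A) →
               (∀ f → ∑ xs f ≡ ∑ ys (f ∘ g)) →
               ∀ m (f : Vec A m → ℕ) → ∑ (allVec xs m) f ≡ ∑ (allVec ys m) (f ∘ Vec.map g)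
∑-allVec-map xs ys g ∑-g zero    f = refl
∑-allVec-map xs ys g ∑-g (suc m) f = begin
  ∑ (allVec xs (suc m)) f                               ≡⟨ ∑-allVec-∷ xs m f ⟩
  ∑[ a ∈ xs ] ∑ (allVec xs m) (f ∘ (a ∷_))              ≡⟨ ∑-cong xs (λ a → ∑-allVec-map xs ys g ∑-g m _) ⟩
  ∑[ a ∈ xs ] ∑[ v ∈ allVec ys m ] f (a ∷ Vec.map g v)  ≡⟨ ∑-g _ ⟩
  ∑[ c ∈ ys ] ∑[ v ∈ allVec ys m ] f (g c ∷ Vec.map g v) ≡⟨ sym (∑-allVec-∷ ys m _) ⟩
  ∑ (allVec ys (suc m)) (f ∘ Vec.map g)                 ∎
  where open ≡-Reasoning

allΣ≡allVec : ∀ b → allΣ b ≡ allVec (true ∷ false ∷ []) b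
allΣ≡allVec zero    = refl
allΣ≡allVec (suc b) = cong (concatMap (λ v → map (_∷ v) (true ∷ false ∷ []))) (allΣ≡allVec b)

toℕ-sucMod : ∀ (i : Fin (suc n)) → toℕ (sucMod i) ≡ suc (toℕ i) % suc n
toℕ-sucMod i = toℕ-fromℕ< _

sucMod-inject₁ : ∀ (j : Fin n) → sucMod (inject₁ j) ≡ suc j
sucMod-inject₁ {n} j = toℕ-injective (begin
  toℕ (sucMod (inject₁ j))       ≡⟨ toℕ-sucMod (inject₁ j) ⟩
  suc (toℕ (inject₁ j)) % suc n  ≡⟨ cong (λ k → suc k % suc n) (toℕ-inject₁ j) ⟩
  suc (toℕ j) % suc n            ≡⟨ m<n⇒m%n≡m (s≤s (toℕ<n j)) ⟩
  suc (toℕ j)                    ∎)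
  where open ≡-Reasoning

sucMod-fromℕ : ∀ n → sucMod (fromℕ n) ≡ zero
sucMod-fromℕ n = toℕ-injective (begin
  toℕ (sucMod (fromℕ n))       ≡⟨ toℕ-sucMod (fromℕ n) ⟩
  suc (toℕ (fromℕ n)) % suc n  ≡⟨ cong (λ k → suc k % suc n) (toℕ-fromℕ n) ⟩
  suc n % suc n                ≡⟨ n%n≡0 (suc n) ⟩
  0                            ∎)
  where open ≡-Reasoning

toℕ-fold-sucMod : ∀ k (i : Fin (suc n)) → toℕ (fold i sucMod k) ≡ (toℕ i + k) % suc n
toℕ-fold-sucMod {n} zero    i = sym (trans (cong (_% suc n) (+-identityʳ (toℕ i))) (m<n⇒m%n≡m (toℕ<n i)))
toℕ-fold-sucMod {n} (suc k) i = begin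
  toℕ (sucMod (fold i sucMod k))               ≡⟨ toℕ-sucMod (fold i sucMod k) ⟩
  (1 + toℕ (fold i sucMod k)) % suc n          ≡⟨ cong (λ t → (1 + t) % suc n) (toℕ-fold-sucMod k i) ⟩
  (1 + (toℕ i + k) % suc n) % suc n            ≡⟨ %-distribˡ-+ 1 ((toℕ i + k) % suc n) (suc n) ⟩
  (1 % suc n + (toℕ i + k) % suc n % suc n) % suc n
    ≡⟨ cong (λ t → (1 % suc n + t) % suc n) (m%n%n≡m%n (toℕ i + k) (suc n)) ⟩
  (1 % suc n + (toℕ i + k) % suc n) % suc n    ≡⟨ %-distribˡ-+ 1 (toℕ i + k) (suc n) ⟨
  (1 + (toℕ i + k)) % suc n                    ≡⟨ cong (_% suc n) (sym (+-suc (toℕ i) k)) ⟩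
  (toℕ i + suc k) % suc n                      ∎
  where open ≡-Reasoning

fold-sucMod-combine : ∀ {m r} (q : Fin (suc m)) (s : Fin (suc r)) →
                      fold (combine q s) sucMod (suc r) ≡ combine (sucMod q) s
fold-sucMod-combine {m} {r} q s = toℕ-injective (begin
  toℕ (fold (combine q s) sucMod R)    ≡⟨ toℕ-fold-sucMod R (combine q s) ⟩
  (toℕ (combine q s) + R) % (M * R)    ≡⟨ cong (_% (M * R)) (cong (_+ R) (toℕ-combine q s)) ⟩
  (R * toℕ q + toℕ s + R) % (M * R)    ≡⟨ cong (_% (M * R)) (regroup R (toℕ q) (toℕ s)) ⟩
  (suc (toℕ q) * R + toℕ s) % (M * R)  ≡⟨ [m*n+o]%[p*n]≡[m*n]%[p*n]+o (suc (toℕ q)) M (toℕ<n s) ⟩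
  suc (toℕ q) * R % (M * R) + toℕ s    ≡⟨ cong (_+ toℕ s) (m%n*o≡m*o%[n*o] (suc (toℕ q)) M R) ⟨
  suc (toℕ q) % M * R + toℕ s          ≡⟨ cong (λ k → k * R + toℕ s) (toℕ-sucMod q) ⟨
  toℕ (sucMod q) * R + toℕ s           ≡⟨ cong (_+ toℕ s) (*-comm (toℕ (sucMod q)) R) ⟩
  R * toℕ (sucMod q) + toℕ s           ≡⟨ toℕ-combine (sucMod q) s ⟨
  toℕ (combine (sucMod q) s)           ∎)
  where
  open ≡-Reasoning
  M R : ℕ
  M = suc m
  R = suc r
  regroup : ∀ R a t → R * a + t + R ≡ suc a * R + t
  regroup = solve-∀

remQuot-fold-sucMod : ∀ {m r} (i : Fin (suc m * suc r)) →
                      remQuot {suc m} (suc r) (fold i sucMod (suc r))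
                        ≡ (sucMod (quotient {suc m} (suc r) i) , remainder {suc m} (suc r) i)
remQuot-fold-sucMod {m} {r} i = begin
  remQuot {suc m} (suc r) (fold i sucMod (suc r))
    ≡⟨ cong (λ j → remQuot {suc m} (suc r) (fold j sucMod (suc r))) (combine-remQuot {suc m} (suc r) i) ⟨
  remQuot {suc m} (suc r) (fold (combine q s) sucMod (suc r))
    ≡⟨ cong (remQuot {suc m} (suc r)) (fold-sucMod-combine q s) ⟩
  remQuot {suc m} (suc r) (combine (sucMod q) s)
    ≡⟨ remQuot-combine (sucMod q) s ⟩
  (sucMod q , s)
    ∎
  where
  open ≡-Reasoning
  q : Fin (suc m)
  q = quotient {suc m} (suc r) i
  s : Fin (suc r)
  s = remainder {suc m} (suc r) i

lookup-∷ʳ-inject₁ : ∀ (v : Vec A n) a (j : Fin n) → lookup (v ∷ʳ a) (inject₁ j) ≡ lookup v j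
lookup-∷ʳ-inject₁ (x ∷ v) a zero    = refl
lookup-∷ʳ-inject₁ (x ∷ v) a (suc j) = lookup-∷ʳ-inject₁ v a j

lookup-∷ʳ-fromℕ : ∀ (v : Vec A n) a → lookup (v ∷ʳ a) (fromℕ n) ≡ a
lookup-∷ʳ-fromℕ []      a = refl
lookup-∷ʳ-fromℕ (x ∷ v) a = lookup-∷ʳ-fromℕ v a

lookup-rotate : ∀ (v : Vec A n) → lookup v ∘ sucMod ≗ lookup (rotate v)
lookup-rotate {n = suc n} (a ∷ v) i with i ≟ fromℕ n
... | yes refl = trans (cong (lookup (a ∷ v)) (sucMod-fromℕ n)) (sym (lookup-∷ʳ-fromℕ v a))
... | no  i≢last =
  subst (λ i → lookup (a ∷ v) (sucMod i) ≡ lookup (v ∷ʳ a) i) (inject₁-lower₁ i n≢i)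
        (trans (cong (lookup (a ∷ v)) (sucMod-inject₁ j)) (sym (lookup-∷ʳ-inject₁ v a j)))
  where
  n≢i : n ≢ toℕ i
  n≢i n≡i = i≢last (toℕ-injective (trans (sym n≡i) (sym (toℕ-fromℕ n))))
  j : Fin n
  j = lower₁ i n≢i

iterate-shift : ∀ k (x : Input n b) i → iterate shift x k i ≡ x (fold i sucMod k)
iterate-shift zero    x i = refl
iterate-shift (suc k) x i = iterate-shift k (shift x) i

∑-allInputs : ∀ n b (F : Input n b → ℕ) → ∑ (allInputs n b) F ≡ ∑ (allVec (allΣ b) n) (F ∘ lookup)
∑-allInputs n b F = ∑-map lookup (allVec (allΣ b) n) F

-- Inputs are functions, so sums over them can only be compared for F respecting _≗_.
∑-shift : ∀ n b (F : Input n b → ℕ) → F Preserves _≗_ ⟶ _≡_ →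
          ∑ (allInputs n b) (F ∘ shift) ≡ ∑ (allInputs n b) F
∑-shift n b F F-resp = begin
  ∑ (allInputs n b) (F ∘ shift)                     ≡⟨ ∑-allInputs n b (F ∘ shift) ⟩
  ∑[ v ∈ allVec (allΣ b) n ] F (shift (lookup v))    ≡⟨ ∑-cong (allVec (allΣ b) n) (F-resp ∘ lookup-rotate) ⟩
  ∑[ v ∈ allVec (allΣ b) n ] F (lookup (rotate v))   ≡⟨ ∑-allVec-rotate (allΣ b) n (F ∘ lookup) ⟩
  ∑ (allVec (allΣ b) n) (F ∘ lookup)                 ≡⟨ ∑-allInputs n b F ⟨
  ∑ (allInputs n b) F                                ∎
  where open ≡-Reasoning

∑-orbit-resp-≗ : ∀ k (F : Input n b → ℕ) → F Preserves _≗_ ⟶ _≡_ →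
               (λ x → ∑ (List.iterate shift x k) F) Preserves _≗_ ⟶ _≡_
∑-orbit-resp-≗ zero    F F-resp x≗y = refl
∑-orbit-resp-≗ (suc k) F F-resp x≗y = cong₂ _+_ (F-resp x≗y) (∑-orbit-resp-≗ k F F-resp (x≗y ∘ sucMod))

∑-orbit : ∀ n b k (F : Input n b → ℕ) → F Preserves _≗_ ⟶ _≡_ →
          ∑[ x ∈ allInputs n b ] ∑ (List.iterate shift x k) F ≡ k * ∑ (allInputs n b) F
∑-orbit n b zero    F F-resp = ∑-zero (allInputs n b)
∑-orbit n b (suc k) F F-resp = begin
  ∑[ x ∈ allInputs n b ] (F x + ∑ (List.iterate shift (shift x) k) F)
    ≡⟨ ∑-distrib-+ (allInputs n b) F _ ⟩
  ∑ (allInputs n b) F + ∑[ x ∈ allInputs n b ] ∑ (List.iterate shift (shift x) k) F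
    ≡⟨ cong (_+_ (∑ (allInputs n b) F)) (∑-shift n b _ (∑-orbit-resp-≗ k F F-resp)) ⟩
  ∑ (allInputs n b) F + ∑[ x ∈ allInputs n b ] ∑ (List.iterate shift x k) F
    ≡⟨ cong (_+_ (∑ (allInputs n b) F)) (∑-orbit n b k F F-resp) ⟩
  suc k * ∑ (allInputs n b) F
    ∎
  where open ≡-Reasoning

Correct : (Input n b → Fin n) → Input n b → Set
Correct h x = h x ≡ sucMod (h (shift x))

correct? : (h : Input n b → Fin n) (x : Input n b) → Dec (Correct h x)
correct? h x = h x ≟ sucMod (h (shift x))

failure : (Input n b → Fin n) → Input n b → ℕ
failure h x = 𝟙¬ (correct? h x)

failure-cong : ∀ {h g : Input n b → Fin n} → h ≗ g → failure h ≗ failure g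
failure-cong h≗g x = cong₂ (λ u v → 𝟙¬ (u ≟ sucMod v)) (h≗g x) (h≗g (shift x))

failure-resp-≗ : ∀ (h : Input n b → Fin n) → h Preserves _≗_ ⟶ _≡_ → failure h Preserves _≗_ ⟶ _≡_
failure-resp-≗ h h-resp x≗y = cong₂ (λ u v → 𝟙¬ (u ≟ sucMod v)) (h-resp x≗y) (h-resp (x≗y ∘ sucMod))

badCount≡∑failure : ∀ n b (h : Input n b → Fin n) → badCount n b h ≡ ∑ (allInputs n b) (failure h)
badCount≡∑failure n b h = length-filter-¬ (correct? h) (allInputs n b)

badCount-cong : ∀ {h g : Input n b → Fin n} → h ≗ g → badCount n b h ≡ badCount n b g
badCount-cong {n} {b} {h} {g} h≗g = begin
  badCount n b h                ≡⟨ badCount≡∑failure n b h ⟩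
  ∑ (allInputs n b) (failure h) ≡⟨ ∑-cong (allInputs n b) (failure-cong h≗g) ⟩
  ∑ (allInputs n b) (failure g) ≡⟨ badCount≡∑failure n b g ⟨
  badCount n b g                ∎
  where open ≡-Reasoning

correct-along-orbit : ∀ k (h : Input n b → Fin n) x → All (Correct h) (List.iterate shift x k) →
                      h x ≡ fold (h (iterate shift x k)) sucMod k
correct-along-orbit zero    h x []           = refl
correct-along-orbit (suc k) h x (hx ∷ rest) = trans hx (cong sucMod (correct-along-orbit k h (shift x) rest))

run-cong : ∀ {d} (A : QueryAlg n b d) → run A Preserves _≗_ ⟶ _≡_
run-cong (output i)  x≗y = refl
run-cong (query i k) {x} {y} x≗y rewrite x≗y i = run-cong (k (y i)) x≗y

-- Blocks of r symbols as single symbols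

module Blocks (b r : ℕ) where

  pack : Vec (Σᵇ b) r → Σᵇ (b * r)
  pack c = cast (*-comm r b) (concat c)

  unpack : Σᵇ (b * r) → Fin r → Σᵇ b
  unpack w s = tabulate (λ k → lookup w (Fin.cast (*-comm r b) (combine s k)))

  unpack-pack : ∀ c s → unpack (pack c) s ≡ lookup c s
  unpack-pack c s = trans
    (tabulate-cong (λ k → trans (lookup-cast (*-comm r b) (concat c) (combine s k)) (lookup-concat c s k)))
    (tabulate∘lookup (lookup c s))

  ∑-pack : ∀ (f : Σᵇ (b * r) → ℕ) → ∑ (allΣ (b * r)) f ≡ ∑ (allVec (allΣ b) r) (f ∘ pack)
  ∑-pack f = begin
    ∑ (allΣ (b * r)) f                                ≡⟨ cong (λ L → ∑ L f) (allΣ≡allVec (b * r)) ⟩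
    ∑ (allVec bits (b * r)) f                         ≡⟨ ∑-allVec-cast bits (*-comm r b) f ⟨
    ∑ (allVec bits (r * b)) (f ∘ cast (*-comm r b))   ≡⟨ ∑-allVec-concat bits r b _ ⟩
    ∑ (allVec (allVec bits b) r) (f ∘ pack)           ≡⟨ cong (λ L → ∑ (allVec L r) (f ∘ pack)) (allΣ≡allVec b) ⟨
    ∑ (allVec (allΣ b) r) (f ∘ pack)                  ∎
    where
    open ≡-Reasoning
    bits : List Bool
    bits = true ∷ false ∷ []

  module Decoding (m : ℕ) where

    block : Fin (m * r) → Fin m
    block = quotient r

    offset : Fin (m * r) → Fin r
    offset = remainder {m} r

    decode : Input m (b * r) → Input (m * r) b
    decode y i = unpack (y (block i)) (offset i)

    decode-map-pack : ∀ (c : Vec (Vec (Σᵇ b) r) m) → decode (lookup (Vec.map pack c)) ≗ lookup (concat c)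
    decode-map-pack c i = begin
      unpack (lookup (Vec.map pack c) (block i)) (offset i)  ≡⟨ cong (λ w → unpack w (offset i)) (lookup-map (block i) pack c) ⟩
      unpack (pack (lookup c (block i))) (offset i)          ≡⟨ unpack-pack (lookup c (block i)) (offset i) ⟩
      lookup (lookup c (block i)) (offset i)                 ≡⟨ lookup-concat c (block i) (offset i) ⟨
      lookup (concat c) (combine (block i) (offset i))       ≡⟨ cong (lookup (concat c)) (combine-remQuot {m} r i) ⟩
      lookup (concat c) i                                    ∎
      where open ≡-Reasoning

    ∑-decode : ∀ (F : Input (m * r) b → ℕ) → F Preserves _≗_ ⟶ _≡_ →
               ∑ (allInputs m (b * r)) (F ∘ decode) ≡ ∑ (allInputs (m * r) b) F
    ∑-decode F F-resp = begin
      ∑ (allInputs m (b * r)) (F ∘ decode)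
        ≡⟨ ∑-allInputs m (b * r) (F ∘ decode) ⟩
      ∑[ y ∈ allVec (allΣ (b * r)) m ] F (decode (lookup y))
        ≡⟨ ∑-allVec-map (allΣ (b * r)) (allVec (allΣ b) r) pack ∑-pack m _ ⟩
      ∑[ c ∈ allVec (allVec (allΣ b) r) m ] F (decode (lookup (Vec.map pack c)))
        ≡⟨ ∑-cong (allVec (allVec (allΣ b) r) m) (F-resp ∘ decode-map-pack) ⟩
      ∑ (allVec (allVec (allΣ b) r) m) (F ∘ lookup ∘ concat)
        ≡⟨ ∑-allVec-concat (allΣ b) m r (F ∘ lookup) ⟨
      ∑ (allVec (allΣ b) (m * r)) (F ∘ lookup)
        ≡⟨ ∑-allInputs (m * r) b F ⟨
      ∑ (allInputs (m * r) b) F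
        ∎
      where open ≡-Reasoning

    simulate : ∀ {d} → QueryAlg (m * r) b d → QueryAlg m (b * r) d
    simulate (output i)  = output (block i)
    simulate (query i k) = query (block i) (λ w → simulate (k (unpack w (offset i))))

    run-simulate : ∀ {d} (A : QueryAlg (m * r) b d) y → run (simulate A) y ≡ block (run A (decode y))
    run-simulate (output i)  y = refl
    run-simulate (query i k) y = run-simulate (k _) y

+p/D≤r*[+q/D] : ∀ p q r D .{{_ : NonZero D}} → p ≤ r * q → + p ℚ./ D ℚ.≤ (+ r ℚ./ 1) ℚ.* (+ q ℚ./ D)
+p/D≤r*[+q/D] p q r (suc D) p≤rq = ℚ.toℚᵘ-cancel-≤
  (ℚᵘ.≤-respˡ-≃ (ℚᵘ.≃-sym (ℚ.toℚᵘ-fromℚᵘ (mkℚᵘ (+ p) D)))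
    (ℚᵘ.≤-respʳ-≃ (ℚᵘ.≃-sym (ℚᵘ.≃-trans (ℚ.toℚᵘ-homo-* (+ r ℚ./ 1) (+ q ℚ./ suc D))
                     (ℚᵘ.*-cong (ℚ.toℚᵘ-fromℚᵘ (mkℚᵘ (+ r) 0)) (ℚ.toℚᵘ-fromℚᵘ (mkℚᵘ (+ q) D)))))
      (*≤* (subst₂ ℤ._≤_ (sym lhs) (sym rhs) (ℤ.+≤+ (*-monoˡ-≤ (suc D) p≤rq))))))
  where
  lhs : + p ℤ.* + (1 * suc D) ≡ + (p * suc D)
  lhs = trans (cong (λ k → + p ℤ.* + k) (*-identityˡ (suc D))) (sym (ℤ.pos-* p (suc D)))
  rhs : + r ℤ.* + q ℤ.* + suc D ≡ + (r * q * suc D)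
  rhs = trans (cong (ℤ._* + suc D) (sym (ℤ.pos-* r q))) (sym (ℤ.pos-* (r * q) (suc D)))

-- The two denominators are equal but carry different NonZero instances.
/-scale-≤ : ∀ {p q D₁ D₂} r .{{_ : NonZero D₁}} .{{_ : NonZero D₂}} {δ : ℚ} → D₁ ≡ D₂ → p ≤ r * q →
            + q ℚ./ D₂ ℚ.≤ δ → + p ℚ./ D₁ ℚ.≤ (+ r ℚ./ 1) ℚ.* δ
/-scale-≤ {p} {q} {D} r refl p≤rq q/D≤δ = ℚ.≤-trans (+p/D≤r*[+q/D] p q r D p≤rq)
  (ℚ.*-monoˡ-≤-nonNeg (+ r ℚ./ 1) {{ℚ.normalize-nonNeg r 1}} q/D≤δ)

module Reduction (b m′ r′ : ℕ) where

  m r : ℕ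
  m = suc m′
  r = suc r′

  open Blocks b r
  open Decoding m

  decode-shift : ∀ (y : Input m (b * r)) → decode (shift y) ≗ iterate shift (decode y) r
  decode-shift y i = begin
    decode (shift y) i             ≡⟨ cong (uncurry (λ q s → unpack (y q) s)) (remQuot-fold-sucMod i) ⟨
    decode y (fold i sucMod r)     ≡⟨ iterate-shift r (decode y) i ⟨
    iterate shift (decode y) r i   ∎
    where open ≡-Reasoning

  module _ {d} (A : QueryAlg (m * r) b d) where

    h : Input (m * r) b → Fin (m * r)
    h = run A

    h′ : Input m (b * r) → Fin m
    h′ = run (simulate A)

    orbit : Input m (b * r) → List (Input (m * r) b)
    orbit y = List.iterate shift (decode y) r

    simulate-correct : ∀ y → All (Correct h) (orbit y) → Correct h′ y
    simulate-correct y all-correct = begin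
      h′ y                                          ≡⟨ run-simulate A y ⟩
      block (h (decode y))                          ≡⟨ cong block (correct-along-orbit r h (decode y) all-correct) ⟩
      block (fold (h (iterate shift (decode y) r)) sucMod r)
        ≡⟨ cong (λ i → block (fold i sucMod r)) (run-cong A (decode-shift y)) ⟨
      block (fold (h (decode (shift y))) sucMod r)  ≡⟨ cong proj₁ (remQuot-fold-sucMod (h (decode (shift y)))) ⟩
      sucMod (block (h (decode (shift y))))         ≡⟨ cong sucMod (run-simulate A (shift y)) ⟨
      sucMod (h′ (shift y))                         ∎
      where open ≡-Reasoning

    badCount-simulate : badCount m (b * r) h′ ≤ r * badCount (m * r) b h
    badCount-simulate = begin
      badCount m (b * r) h′
        ≡⟨ badCount≡∑failure m (b * r) h′ ⟩
      ∑ (allInputs m (b * r)) (failure h′)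
        ≤⟨ ∑-mono-≤ (allInputs m (b * r))
             (λ y → 𝟙¬-union-bound (correct? h′ y) (correct? h) (orbit y) (simulate-correct y)) ⟩
      ∑[ y ∈ allInputs m (b * r) ] ∑ (orbit y) (failure h)
        ≡⟨ ∑-decode _ (∑-orbit-resp-≗ r (failure h) failure-h-resp) ⟩
      ∑[ x ∈ allInputs (m * r) b ] ∑ (List.iterate shift x r) (failure h)
        ≡⟨ ∑-orbit (m * r) b r (failure h) failure-h-resp ⟩
      r * ∑ (allInputs (m * r) b) (failure h)
        ≡⟨ cong (r *_) (badCount≡∑failure (m * r) b h) ⟨
      r * badCount (m * r) b h
        ∎
      where
      open ≤-Reasoning
      failure-h-resp : failure h Preserves _≗_ ⟶ _≡_
      failure-h-resp = failure-resp-≗ h (run-cong A)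

  lphs-blocks : ∀ d δ → LPHSExists (m * r) b d δ → LPHSExists m (b * r) d ((+ r ℚ./ 1) ℚ.* δ)
  lphs-blocks d δ (h₀ , (A , h₀≗A) , error≤δ) =
    h′ A , (simulate A , λ _ → refl) ,
    /-scale-≤ r {{m^n≢0 2 (b * r * m)}} {{m^n≢0 2 (b * (m * r))}}
      (cong (2 ^_) (trans (*-assoc b r m) (cong (b *_) (*-comm r m))))
      (≤-trans (badCount-simulate A) (≤-reflexive (cong (r *_) (sym (badCount-cong h₀≗A)))))
      error≤δ

lemma3 : (n b d r : ℕ) → .{{_ : NonZero r}} → (δ : ℚ) → r ∣ n →
    LPHSExists n b d δ → LPHSExists (n / r) (b * r) d ((+ r ℚ./ 1) ℚ.* δ)
lemma3 .(zero * suc r) b d (suc r) δ (divides zero refl) (h , _) with h (λ ())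
... | ()
lemma3 .(suc m * suc r) b d (suc r) δ (divides (suc m) refl) lphs =
  subst (λ k → LPHSExists k (b * suc r) d ((+ suc r ℚ./ 1) ℚ.* δ)) (sym (m*n/n≡m (suc m) (suc r)))
        (Reduction.lphs-blocks b m r d δ lphs)
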